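{- For all integers $k$ and $m$ with $1 \leq m \leq k-1$, we have \[ f\left( n, k, \binom{k}{2} - m(k-m) - \binom{m}{2} + m + 1 \right) = \Omega\left(n^{1/m}\right), \] where $k$ and $m$ are fixed and the asymptotics are as $n\to\infty$.
   Context: For positive integers $p,q$ with $1\le q\le\binom p2$, a $(p,q)$-coloring of the complete graph $K_n$ is an edge-coloring of $K_n$ in which every set of $p$ vertices spans a clique whose edges receive at least $q$ distinct colors. $f(n,p,q)$ denotes the minimum number of colors in a $(p,q)$-coloring of $K_n$. Asymptotic notation is in $n$, with all other parameters treated as constants (implied constants may depend on them). -}

module Defs where

open import Data.Nat using (ℕ; suc; _+_; _*_; _∸_; _^_; _≤_)
open import Data.Nat.Combinatorics using (_C_)
open import Data.Fin using (Fin) renaming (_<_ to _<ᶠ_)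
open import Data.Product using (Σ; ∃; _×_; proj₁; proj₂)
open import Function.Definitions using (Injective)
open import Relation.Binary.PropositionalEquality using (_≡_)

-- An edge-colouring of K_n with (at most) r colours: colours of the edge
-- {i,j} is c i j; the value on the diagonal is irrelevant.
Colouring : ℕ → ℕ → Set
Colouring n r = Fin n → Fin n → Fin r

Symmetric : ∀ {n r} → Colouring n r → Set
Symmetric c = ∀ i j → c i j ≡ c j i

-- Every set of p vertices (given as an injective map Fin p → Fin n) spans a
-- clique whose edges receive at least q distinct colours: there are q edges
-- {v a, v b} (a < b) of the clique with pairwise distinct colours.
IsPQColouring : (n p q r : ℕ) → Colouring n r → Set
IsPQColouring n p q r c =
  Symmetric c ×
  ((v : Fin p → Fin n) → Injective _≡_ _≡_ v →
    Σ (Fin q → Fin p × Fin p) λ e →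
      (∀ t → proj₁ (e t) <ᶠ proj₂ (e t)) ×
      (∀ s t → c (v (proj₁ (e s))) (v (proj₂ (e s)))
             ≡ c (v (proj₁ (e t))) (v (proj₂ (e t))) → s ≡ t))

HasPQColouring : (n p q r : ℕ) → Set
HasPQColouring n p q r = Σ (Colouring n r) (IsPQColouring n p q r)

-- f(n,p,q) = r : r is the minimum number of colours of a (p,q)-colouring of K_n.
IsF : (n p q r : ℕ) → Set
IsF n p q r = HasPQColouring n p q r × (∀ r' → HasPQColouring n p q r' → r ≤ r')

-- q = C(k,2) - m(k-m) - C(m,2) + m + 1  (the subtractions are exact for m ≤ k)
qOf : ℕ → ℕ → ℕ
qOf k m = (((k C 2) ∸ m * (k ∸ m)) ∸ (m C 2)) + m + 1

-- Greedily pick vertices x₁, …, x_m of K_n such that every edge from x_i to a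
-- later vertex has one colour γ_i: given a pool of candidates, take its first
-- vertex x and keep only the largest colour class of the edges from x into
-- the rest, which shrinks the pool by a factor of about r. A pool of size
-- about k·r^m thus leaves j = k − m vertices after m rounds, and the clique
-- on x₁, …, x_m and these j vertices has at most m + C(j,2) colours, which is
-- one less than q = C(k,2) − m(k−m) − C(m,2) + m + 1. Hence a (k,q)-colouring
-- with r colours needs n ≤ (k+1)·r^m.
module Submission where

open import Defs
open import Data.Nat
  using (ℕ; zero; suc; _+_; _*_; _∸_; _^_; _≤_; _<_; s≤s; _<?_)
open import Data.Nat.Properties
open import Data.Nat.Combinatorics using (_C_; nC1≡n; nCk+nC[k+1]≡[n+1]C[k+1])
open import Data.Nat.Solver using (module +-*-Solver)
open import Algebra.Properties.CommutativeSemigroup *-commutativeSemigroup using (x∙yz≈y∙xz)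
open import Data.Fin using (Fin; zero; suc; _↑ˡ_; _↑ʳ_; splitAt) renaming (_<_ to _<ᶠ_)
open import Data.Fin.Properties
  using (↑ˡ-injective; ↑ʳ-injective; splitAt-↑ˡ; splitAt-↑ʳ; pigeonhole)
  renaming (_≟_ to _≟ᶠ_; <⇒≢ to <ᶠ⇒≢)
open import Data.Vec.Functional using () renaming (_∷_ to _∷ᵛ_)
open import Data.List using (List; []; _∷_; length; filter; allFin)
open import Data.List.Properties using (length-tabulate)
open import Data.List.Relation.Unary.All as All using (All; []; _∷_)
open import Data.List.Relation.Unary.All.Properties using (all-filter; filter⁺)
open import Data.List.Relation.Unary.Any using (here; there)
open import Data.List.Relation.Unary.AllPairs using ([]; _∷_)
open import Data.List.Relation.Unary.Unique.Propositional using (Unique)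
open import Data.List.Relation.Unary.Unique.Propositional.Properties using (allFin⁺)
open import Data.List.Relation.Binary.Sublist.Propositional using (_⊆_; []; _∷_; _∷ʳ_; ⊆-trans)
open import Data.List.Relation.Binary.Sublist.Propositional.Properties
  using (All-resp-⊆; Any-resp-⊆; filter-⊆)
open import Data.List.Membership.Propositional using (_∈_)
open import Data.List.Membership.Propositional.Properties using (∈-allFin)
open import Data.Product using (∃; ∃₂; _×_; _,_)
open import Data.Empty using (⊥-elim)
open import Function using (_∘_; id)
open import Function.Definitions using (Injective)
open import Relation.Nullary using (yes; no)
open import Relation.Unary using (Decidable)
open import Relation.Unary.Properties using (∁?)
open import Relation.Binary.Definitions using (DecidableEquality)
open import Relation.Binary.PropositionalEquality
  using (_≡_; _≢_; refl; sym; trans; cong; cong₂; subst; module ≡-Reasoning)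

length-filter-∁ : ∀ {A : Set} {P : A → Set} (P? : Decidable P) (xs : List A) →
  length (filter P? xs) + length (filter (∁? P?) xs) ≡ length xs
length-filter-∁ P? [] = refl
length-filter-∁ P? (x ∷ xs) with P? x
... | yes _ = cong suc (length-filter-∁ P? xs)
... | no _ = trans (+-suc _ _) (cong suc (length-filter-∁ P? xs))

length-allFin : ∀ k → length (allFin k) ≡ k
length-allFin k = length-tabulate id

Unique-resp-⊆ : ∀ {A : Set} {xs ys : List A} → xs ⊆ ys → Unique ys → Unique xs
Unique-resp-⊆ [] [] = []
Unique-resp-⊆ (_ ∷ʳ xs⊆ys) (_ ∷ u) = Unique-resp-⊆ xs⊆ys u
Unique-resp-⊆ (refl ∷ xs⊆ys) (x∉ys ∷ u) = All-resp-⊆ xs⊆ys x∉ys ∷ Unique-resp-⊆ xs⊆ys u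

module _ {A B : Set} (_≟_ : DecidableEquality B) (f : A → B) where

  pigeonhole-⊆ : ∀ (cs : List B) t {xs} → All (λ x → f x ∈ cs) xs → length cs * t < length xs →
    ∃₂ λ γ ys → ys ⊆ xs × All (λ y → f y ≡ γ) ys × t < length ys
  pigeonhole-⊆ [] t {[]} [] ()
  pigeonhole-⊆ [] t {_ ∷ _} (() ∷ _) _
  pigeonhole-⊆ (γ ∷ cs) t {xs} f∈ long with t <? length (filter (λ x → f x ≟ γ) xs)
  ... | yes t<fibre = γ , _ , filter-⊆ _ xs , all-filter _ xs , t<fibre
  ... | no t≮fibre =
    let δ , ys , ys⊆ , ys-fibre , t<ys = pigeonhole-⊆ cs t rest-in-cs rest-long
    in δ , ys , ⊆-trans ys⊆ (filter-⊆ (∁? P?) xs) , ys-fibre , t<ys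
    where
    P? = λ x → f x ≟ γ
    rest = filter (∁? P?) xs

    in-tail : ∀ {x} → f x ∈ γ ∷ cs → f x ≢ γ → f x ∈ cs
    in-tail (here fx≡γ) fx≢γ = ⊥-elim (fx≢γ fx≡γ)
    in-tail (there fx∈cs) _ = fx∈cs

    rest-in-cs : All (λ x → f x ∈ cs) rest
    rest-in-cs = All.zipWith (λ (∈γcs , ≢γ) → in-tail ∈γcs ≢γ)
      (filter⁺ (∁? P?) f∈ , all-filter (∁? P?) xs)

    rest-long : length cs * t < length rest
    rest-long = +-cancelˡ-< t _ _ (begin-strict
      t + length cs * t                       <⟨ long ⟩
      length xs                               ≡⟨ length-filter-∁ P? xs ⟨
      length (filter P? xs) + length rest     ≤⟨ +-monoˡ-≤ (length rest) (≮⇒≥ t≮fibre) ⟩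
      t + length rest                         ∎)
      where open ≤-Reasoning

↑ˡ≢↑ʳ : ∀ {m n} (i : Fin m) (k : Fin n) → i ↑ˡ n ≢ m ↑ʳ k
↑ˡ≢↑ʳ {m} {n} i k eq
  with () ← trans (sym (splitAt-↑ˡ m i n)) (trans (cong (splitAt m) eq) (splitAt-↑ʳ m n k))

tri : ℕ → ℕ
tri zero = 0
tri (suc j) = j + tri j

tri≡C2 : ∀ j → tri j ≡ j C 2
tri≡C2 zero = refl
tri≡C2 (suc j) = trans (cong₂ _+_ (sym (nC1≡n j)) (tri≡C2 j)) (nCk+nC[k+1]≡[n+1]C[k+1] j 1)

tri-+ : ∀ m j → tri (m + j) ≡ m * j + (tri m + tri j)
tri-+ zero j = refl
tri-+ (suc m) j rewrite tri-+ m j =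
  solve 4 (λ m j a b → (m :+ j) :+ (m :* j :+ (a :+ b)) := (j :+ m :* j) :+ ((m :+ a) :+ b))
    refl m j (tri m) (tri j)
  where open +-*-Solver

qOf-+ : ∀ m j → qOf (m + j) m ≡ suc (m + tri j)
qOf-+ m j = begin
  ((m + j) C 2 ∸ m * (m + j ∸ m)) ∸ m C 2 + m + 1
    ≡⟨ cong₂ (λ a b → (a ∸ m * b) ∸ m C 2 + m + 1) (trans (sym (tri≡C2 (m + j))) (tri-+ m j)) (m+n∸m≡n m j) ⟩
  (m * j + (tri m + tri j) ∸ m * j) ∸ m C 2 + m + 1
    ≡⟨ cong₂ (λ a b → a ∸ b + m + 1) (m+n∸m≡n (m * j) _) (sym (tri≡C2 m)) ⟩
  tri m + tri j ∸ tri m + m + 1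
    ≡⟨ cong (λ a → a + m + 1) (m+n∸m≡n (tri m) (tri j)) ⟩
  tri j + m + 1
    ≡⟨ +-comm (tri j + m) 1 ⟩
  suc (tri j + m)
    ≡⟨ cong suc (+-comm (tri j) m) ⟩
  suc (m + tri j) ∎
  where open ≡-Reasoning

threshold : (r j i : ℕ) → ℕ
threshold r j zero = j
threshold r j (suc i) = suc (r * threshold r j i)

threshold-bound : ∀ r' j i → threshold (suc r') j i ≤ suc (i + j) * suc r' ^ i
threshold-bound r' j zero = ≤-trans (n≤1+n j) (≤-reflexive (sym (*-identityʳ (suc j))))
threshold-bound r' j (suc i) = begin
  1 + r * threshold r j i               ≤⟨ +-mono-≤ (m^n>0 r (suc i)) (*-monoʳ-≤ r (threshold-bound r' j i)) ⟩
  r ^ suc i + r * (suc (i + j) * r ^ i) ≡⟨ cong (r ^ suc i +_) (x∙yz≈y∙xz r (suc (i + j)) (r ^ i)) ⟩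
  r ^ suc i + suc (i + j) * r ^ suc i   ∎
  where
  open ≤-Reasoning
  r = suc r'

module _ {n r : ℕ} (c : Colouring n r) where

  record UsesAtMost {p : ℕ} (v : Fin p → Fin n) (s : ℕ) : Set where
    field
      label : (a b : Fin p) → a <ᶠ b → Fin s
      label-colour : ∀ {a b a' b'} (a<b : a <ᶠ b) (a'<b' : a' <ᶠ b') →
        label a b a<b ≡ label a' b' a'<b' → c (v a) (v b) ≡ c (v a') (v b')

  open UsesAtMost

  pq⇒q≤colours : ∀ {p q s} {v : Fin p → Fin n} → IsPQColouring n p q r c →
    Injective _≡_ _≡_ v → UsesAtMost v s → q ≤ s
  pq⇒q≤colours {v = v} (_ , rainbow) v-inj L
    with e , e< , e-distinct ← rainbow v v-inj
    = ≮⇒≥ λ s<q →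
      let t , u , t<u , same = pigeonhole s<q (λ t → label L _ _ (e< t))
      in <ᶠ⇒≢ t<u (e-distinct t u (label-colour L (e< t) (e< u) same))

  usesAtMost-∷ : ∀ {p t s x} {v : Fin p → Fin n} (g : Fin p → Fin t) →
    (∀ {b b'} → g b ≡ g b' → c x (v b) ≡ c x (v b')) →
    UsesAtMost v s → UsesAtMost (x ∷ᵛ v) (t + s)
  usesAtMost-∷ {p} {t} {s} {x} {v} g g-colour L = record { label = label′ ; label-colour = colour′ }
    where
    label′ : (a b : Fin (suc p)) → a <ᶠ b → Fin (t + s)
    label′ zero (suc b) _ = g b ↑ˡ s
    label′ (suc a) (suc b) (s≤s a<b) = t ↑ʳ label L a b a<b

    colour′ : ∀ {a b a' b'} (a<b : a <ᶠ b) (a'<b' : a' <ᶠ b') →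
      label′ a b a<b ≡ label′ a' b' a'<b' → c ((x ∷ᵛ v) a) ((x ∷ᵛ v) b) ≡ c ((x ∷ᵛ v) a') ((x ∷ᵛ v) b')
    colour′ {zero} {suc b} {zero} {suc b'} _ _ eq = g-colour (↑ˡ-injective s _ _ eq)
    colour′ {zero} {suc b} {suc a'} {suc b'} _ (s≤s _) eq = ⊥-elim (↑ˡ≢↑ʳ _ _ eq)
    colour′ {suc a} {suc b} {zero} {suc b'} (s≤s _) _ eq = ⊥-elim (↑ˡ≢↑ʳ _ _ (sym eq))
    colour′ {suc a} {suc b} {suc a'} {suc b'} (s≤s a<b) (s≤s a'<b') eq =
      label-colour L a<b a'<b' (↑ʳ-injective t _ _ eq)

  record Clique (S : List (Fin n)) (p s : ℕ) : Set where
    field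
      vertex : Fin p → Fin n
      vertex-injective : Injective _≡_ _≡_ vertex
      vertex∈S : ∀ a → vertex a ∈ S
      few-colours : UsesAtMost vertex s

  open Clique

  empty-clique : ∀ {S} → Clique S 0 0
  empty-clique = record
    { vertex = λ ()
    ; vertex-injective = λ { {()} }
    ; vertex∈S = λ ()
    ; few-colours = record { label = λ () ; label-colour = λ { {()} } }
    }

  clique-resp-⊆ : ∀ {S S' p s} → S ⊆ S' → Clique S p s → Clique S' p s
  clique-resp-⊆ S⊆S' K = record
    { vertex = vertex K
    ; vertex-injective = vertex-injective K
    ; vertex∈S = Any-resp-⊆ S⊆S' ∘ vertex∈S K
    ; few-colours = few-colours K
    }

  clique-∷ : ∀ {S p t s x} → All (x ≢_) S → (K : Clique S p s) (g : Fin p → Fin t) →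
    (∀ {b b'} → g b ≡ g b' → c x (vertex K b) ≡ c x (vertex K b')) →
    Clique (x ∷ S) (suc p) (t + s)
  clique-∷ {S} {p} {t} {s} {x} x∉S K g g-colour = record
    { vertex = x ∷ᵛ vertex K
    ; vertex-injective = injective
    ; vertex∈S = λ { zero → here refl ; (suc a) → there (vertex∈S K a) }
    ; few-colours = usesAtMost-∷ g g-colour (few-colours K)
    }
    where
    x≢vertex : ∀ a → x ≢ vertex K a
    x≢vertex a = All.lookup x∉S (vertex∈S K a)

    injective : Injective _≡_ _≡_ (x ∷ᵛ vertex K)
    injective {zero} {zero} _ = refl
    injective {zero} {suc b} eq = ⊥-elim (x≢vertex b eq)
    injective {suc a} {zero} eq = ⊥-elim (x≢vertex a (sym eq))
    injective {suc a} {suc b} eq = cong suc (vertex-injective K eq)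

  any-clique : ∀ {S} j → Unique S → j ≤ length S → Clique S j (tri j)
  any-clique zero _ _ = empty-clique
  any-clique {x ∷ S} (suc j) (x∉S ∷ u) (s≤s j≤|S|) =
    clique-∷ x∉S (any-clique j u j≤|S|) id (cong (c x ∘ vertex (any-clique j u j≤|S|)))

  greedy-clique : ∀ {S} i j → Unique S → threshold r j i < length S → Clique S (i + j) (i + tri j)
  greedy-clique zero j u long = any-clique j u (<⇒≤ long)
  greedy-clique {x ∷ S} (suc i) j (x∉S ∷ u) (s≤s long)
    with γ , T , T⊆S , T-colour , T-long ← pigeonhole-⊆ _≟ᶠ_ (c x) (allFin r) (threshold r j i)
           (All.universal (∈-allFin ∘ c x) S)
           (subst (λ l → l * threshold r j i < length S) (sym (length-allFin r)) long)
    = clique-∷ {t = 1} x∉S (clique-resp-⊆ T⊆S K) (λ _ → zero) λ _ →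
        trans (colour-γ _) (sym (colour-γ _))
    where
    K = greedy-clique i j (Unique-resp-⊆ T⊆S u) T-long
    colour-γ : ∀ b → c x (vertex K b) ≡ γ
    colour-γ b = All.lookup T-colour (vertex∈S K b)

  pq⇒n≤threshold : ∀ m j → IsPQColouring n (m + j) (suc (m + tri j)) r c → n ≤ threshold r j m
  pq⇒n≤threshold m j pq = ≮⇒≥ λ threshold<n →
    let K = greedy-clique m j (allFin⁺ n) (subst (threshold r j m <_) (sym (length-allFin n)) threshold<n)
    in n≮n _ (pq⇒q≤colours pq (vertex-injective K) (few-colours K))

theorem1p3 : ∀ (k m : ℕ) → 1 ≤ m → m ≤ k ∸ 1 →
    ∃ λ (d : ℕ) → ∃ λ (N : ℕ) → ∀ (n : ℕ) → N ≤ n →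
    ∀ (r : ℕ) → IsF n k (qOf k m) r → n ≤ suc d * r ^ m
theorem1p3 k m _ m≤k∸1 with j , refl ← m≤n⇒∃[o]m+o≡n (≤-trans m≤k∸1 (m∸n≤m k 1)) =
  m + j , 1 , bound
  where
  bound : ∀ n → 1 ≤ n → ∀ r → IsF n (m + j) (qOf (m + j) m) r → n ≤ suc (m + j) * r ^ m
  bound (suc _) _ zero ((c , _) , _) with () ← c zero zero
  bound n _ (suc r') ((c , pq) , _) = ≤-trans
    (pq⇒n≤threshold c m j (subst (λ q → IsPQColouring n (m + j) q (suc r') c) (qOf-+ m j) pq))
    (threshold-bound r' j m)
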